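{- Let $T_1$ be a heap-ordered tree, let $v,w$ be nodes of $T_1$ with $u=\mathit{nca}_{T_1}(v,w)\notin\{v,w\}$, let $q$ be the child of $u$ that is an ancestor of $v$, let $T_2$ be the subtree of $T_1$ rooted at $q$, and let $T$ be the tree produced by $\mathit{merge}(v,w)$. Let $x,y$ be nodes of $T_1$. If both $x$ and $y$ are in $T_2$, or neither $x$ nor $y$ is in $T_2$, then $\mathit{nca}_T(x,y)=\min(T_1[x,y])$. If exactly one of them, say $x$, is in $T_2$, then $\mathit{nca}_T(x,y)=\min(T_2[x,v]\cup T_1[w,y])$.
   Context: A heap-ordered tree is a rooted tree whose nodes are distinct elements of a totally ordered set, with every non-root node greater than its parent; a node is its own ancestor. $\mathit{merge}(v,w)$: letting $P$ and $Q$ be the paths from $v$ and $w$ to the root, every node $z\in P\cup Q$ gets as its new parent the largest node of $P\cup Q$ smaller than $z$ (no parent if none), while all other nodes keep their parents. For a tree $S$ and nodes $a,b$ of $S$, $S[a,b]$ denotes the set of nodes on the unique path connecting $a$ and $b$ in $S$, ignoring arc directions. $\mathit{nca}_S(a,b)$ is the nearest common ancestor of $a$ and $b$ in $S$. -}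

module Defs where

open import Level using (Level; _⊔_)
open import Data.Maybe using (Maybe; just; nothing)
open import Data.List using (List; []; _∷_)
open import Data.List.Membership.Propositional using (_∈_)
open import Data.List.Relation.Unary.Unique.Propositional using (Unique)
open import Data.Product using (_×_; Σ; ∃; ∃-syntax; _,_)
open import Data.Sum using (_⊎_)
open import Relation.Nullary using (¬_)
open import Relation.Binary.Core using (Rel)
open import Relation.Binary.PropositionalEquality using (_≡_)

private
  variable
    a ℓ : Level

record HeapTree (A : Set a) (_<_ : Rel A ℓ) : Set (a ⊔ ℓ) where
  field
    nodes         : List A
    nodes-unique  : Unique nodes
    parent        : A → Maybe A
    root          : A
    root∈         : root ∈ nodes
    root-parent   : parent root ≡ nothing
    parent-node   : ∀ {z p} → z ∈ nodes → parent z ≡ just p → p ∈ nodes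
    heap-order    : ∀ {z p} → z ∈ nodes → parent z ≡ just p → p < z
    unique-root   : ∀ {z} → z ∈ nodes → parent z ≡ nothing → z ≡ root

module _ {A : Set a} where

  -- Anc par x y : x is an ancestor of y (w.r.t. parent function par);
  -- every node is its own ancestor.
  data Anc (par : A → Maybe A) : A → A → Set a where
    here : ∀ {x} → Anc par x x
    up   : ∀ {x y c} → par y ≡ just c → Anc par x c → Anc par x y

  NCA : (A → Maybe A) → A → A → A → Set a
  NCA par x y c =
    Anc par c x × Anc par c y × (∀ d → Anc par d x → Anc par d y → Anc par d c)

  Adj : (A → Set a) → (A → Maybe A) → A → A → Set a
  Adj N par x y = N x × N y × (par x ≡ just y ⊎ par y ≡ just x)

  data Walk (N : A → Set a) (par : A → Maybe A) : A → A → List A → Set a where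
    stop : ∀ {x} → N x → Walk N par x x (x ∷ [])
    step : ∀ {x c y ps} → Adj N par x c → Walk N par c y ps → Walk N par x y (x ∷ ps)

  -- OnPath N par x y z : z ∈ S[x,y], i.e. z lies on the (unique) path
  -- (walk without repeated vertices) connecting x and y.
  OnPath : (A → Set a) → (A → Maybe A) → A → A → A → Set a
  OnPath N par x y z = ∃[ ps ] (Walk N par x y ps × Unique ps × z ∈ ps)

  IsMin : (_<_ : Rel A ℓ) → (A → Set a) → A → Set (a ⊔ ℓ)
  IsMin _<_ S m = S m × (∀ z → S z → m ≡ z ⊎ m < z)

module _ {A : Set a} {_<_ : Rel A ℓ} where

  -- z ∈ P ∪ Q, where P, Q are the paths from v, w to the root
  InPQ : HeapTree A _<_ → A → A → A → Set a
  InPQ T v w z = Anc (HeapTree.parent T) z v ⊎ Anc (HeapTree.parent T) z w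

  -- par' is the parent function of the tree produced by merge(v,w) on T:
  -- each z ∈ P ∪ Q gets as parent the largest node of P ∪ Q smaller than z
  -- (no parent if there is none); all other nodes keep their parents.
  IsMerge : HeapTree A _<_ → A → A → (A → Maybe A) → Set (a ⊔ ℓ)
  IsMerge T v w par' =
    (∀ z → InPQ T v w z →
       (∃[ p ] (InPQ T v w p × p < z
                × (∀ r → InPQ T v w r → r < z → ¬ (p < r))
                × par' z ≡ just p))
       ⊎ ((∀ r → InPQ T v w r → ¬ (r < z)) × par' z ≡ nothing))
    × (∀ z → ¬ InPQ T v w z → par' z ≡ HeapTree.parent T z)

-- In a heap-ordered tree the minimum of the path S[x,y] is nca(x,y): the path climbs from x to
-- the nca and descends to y, and it can never leave the subtree of the nca.  Merging v and w sorts
-- P ∪ Q into a chain, keeps every old ancestor relation, and creates only new ancestors d ∈ P ∪ Q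
-- lying below an old ancestor b ∈ P ∪ Q of the node.  A new common ancestor of x and y above the
-- old nca therefore comes from incomparable old ancestors of x and y in P ∪ Q, one on P and one
-- on Q, which forces exactly one of x, y into T₂.  If x ∈ T₂ and y ∉ T₂, the new nca
-- is the smaller of nca(x,v) = min T₂[x,v] and nca(w,y) = min T₁[w,y], now comparable on the chain.

module Submission where

open import Defs
open import Level using (_⊔_)
open import Data.Maybe using (Maybe; just; nothing)
open import Data.List using (List; []; _∷_)
open import Data.List.Membership.Propositional using (_∈_)
open import Data.List.Relation.Unary.Any using (here; there)
open import Data.List.Relation.Unary.All using ([])
open import Data.List.Relation.Unary.All.Properties using (¬Any⇒All¬; All¬⇒¬Any)
open import Data.List.Relation.Unary.AllPairs using ([]; _∷_)
open import Data.List.Relation.Unary.Unique.Propositional using (Unique)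
open import Data.Product using (_×_; ∃-syntax; _,_; proj₁; proj₂)
open import Data.Sum using (_⊎_; inj₁; inj₂; [_,_]′)
open import Data.Empty using (⊥; ⊥-elim)
open import Function using (id)
open import Data.Nat using (ℕ; suc; z≤n; s≤s) renaming (_<_ to _<ℕ_; _≤_ to _≤ℕ_)
open import Data.Nat.Properties using (m≤n⇒m≤1+n)
open import Data.Nat.Induction using (<-wellFounded)
open import Induction.WellFounded using (WellFounded; module Subrelation; module All)
open import Relation.Binary.Construct.On as On using ()
open import Relation.Nullary using (¬_; Dec; yes; no)
open import Relation.Binary.Core using (Rel)
open import Relation.Binary.Structures using (IsStrictTotalOrder)
open import Relation.Binary.Definitions using (tri<; tri≈; tri>)
open import Relation.Binary.PropositionalEquality using (_≡_; refl; sym; trans; subst)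

module _ {a} {A : Set a} {par : A → Maybe A} where

  Anc-trans : ∀ {x y z} → Anc par x y → Anc par y z → Anc par x z
  Anc-trans p here     = p
  Anc-trans p (up e q) = up e (Anc-trans p q)

  Anc-parent⁻¹ : ∀ {d x p} → Anc par d x → par x ≡ just p → d ≡ x ⊎ Anc par d p
  Anc-parent⁻¹ here       _ = inj₁ refl
  Anc-parent⁻¹ (up e′ dp) e with trans (sym e′) e
  ... | refl = inj₂ dp

  Anc-connex : ∀ {c d x} → Anc par c x → Anc par d x → Anc par c d ⊎ Anc par d c
  Anc-connex here       dx         = inj₂ dx
  Anc-connex (up e cp)  here       = inj₁ (up e cp)
  Anc-connex (up e cp) (up e′ dp) with trans (sym e) e′
  ... | refl = Anc-connex cp dp

  Anc-¬parent⇒≡ : ∀ {c x p} → Anc par c x → ¬ Anc par c p → par x ≡ just p → c ≡ x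
  Anc-¬parent⇒≡ here       _   _ = refl
  Anc-¬parent⇒≡ (up e cp) ¬cp e′ with trans (sym e) e′
  ... | refl = ⊥-elim (¬cp cp)

  Anc-orphan⇒≡ : ∀ {c x} → par x ≡ nothing → Anc par c x → c ≡ x
  Anc-orphan⇒≡ _ here = refl
  Anc-orphan⇒≡ e (up e′ _) with trans (sym e) e′
  ... | ()

  child-towards : ∀ {m x} → Anc par m x → ¬ m ≡ x → ∃[ c ] (par c ≡ just m × Anc par c x)
  child-towards here      m≢x = ⊥-elim (m≢x refl)
  child-towards (up e mp) _   = go e mp
    where
    go : ∀ {m z p} → par z ≡ just p → Anc par m p → ∃[ c ] (par c ≡ just m × Anc par c z)
    go e here        = _ , e , here
    go e (up e′ mp′) with go e′ mp′
    ... | c , pc , cz = c , pc , up e cz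

  NCA-sym : ∀ {x y m} → NCA par x y m → NCA par y x m
  NCA-sym (mx , my , greatest) = my , mx , λ d dy dx → greatest d dx dy

module NonStrict {a ℓ} {A : Set a} {_<_ : Rel A ℓ} (sto : IsStrictTotalOrder _≡_ _<_) where
  open IsStrictTotalOrder sto using (compare; irrefl) renaming (trans to <-trans)

  -- Summands ordered as in IsMin (Relation.Binary.Construct.StrictToNonStrict swaps them).
  _≤_ : Rel A (a ⊔ ℓ)
  x ≤ y = x ≡ y ⊎ x < y

  ≤-trans : ∀ {x y z} → x ≤ y → y ≤ z → x ≤ z
  ≤-trans (inj₁ refl) y≤z         = y≤z
  ≤-trans (inj₂ x<y)  (inj₁ refl) = inj₂ x<y
  ≤-trans (inj₂ x<y)  (inj₂ y<z)  = inj₂ (<-trans x<y y<z)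

  ≤-<-trans : ∀ {x y z} → x ≤ y → y < z → x < z
  ≤-<-trans (inj₁ refl) y<z = y<z
  ≤-<-trans (inj₂ x<y)  y<z = <-trans x<y y<z

  <-≤-trans : ∀ {x y z} → x < y → y ≤ z → x < z
  <-≤-trans x<y (inj₁ refl) = x<y
  <-≤-trans x<y (inj₂ y<z)  = <-trans x<y y<z

  ≤⇒≯ : ∀ {x y} → x ≤ y → ¬ y < x
  ≤⇒≯ x≤y y<x = irrefl refl (≤-<-trans x≤y y<x)

  ≤-antisym : ∀ {x y} → x ≤ y → y ≤ x → x ≡ y
  ≤-antisym (inj₁ x≡y) _   = x≡y
  ≤-antisym (inj₂ x<y) y≤x = ⊥-elim (≤⇒≯ y≤x x<y)

  ≤⊎> : ∀ x y → x ≤ y ⊎ y < x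
  ≤⊎> x y with compare x y
  ... | tri< x<y _ _ = inj₁ (inj₂ x<y)
  ... | tri≈ _ x≡y _ = inj₁ (inj₁ x≡y)
  ... | tri> _ _ y<x = inj₂ y<x

  IsMin-∪ : ∀ {S₁ S₂ : A → Set a} {x y} → IsMin _<_ S₁ x → IsMin _<_ S₂ y
          → ∃[ m ] (IsMin _<_ (λ z → S₁ z ⊎ S₂ z) m × (m ≡ x ⊎ m ≡ y))
  IsMin-∪ {x = x} {y} (s₁x , x-least) (s₂y , y-least) with ≤⊎> x y
  ... | inj₁ x≤y = x , (inj₁ s₁x , λ z → [ x-least z , (λ s → ≤-trans x≤y (y-least z s)) ]′) , inj₁ refl
  ... | inj₂ y<x = y , (inj₂ s₂y , λ z → [ (λ s → ≤-trans (inj₂ y<x) (x-least z s)) , y-least z ]′) , inj₂ refl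

  module HeapOrdered (par : A → Maybe A) (Node : A → Set a)
                     (parent-below : ∀ {z p} → Node z → par z ≡ just p → Node p × p < z) where

    Anc⇒≤ : ∀ {d z} → Anc par d z → Node z → Node d × d ≤ z
    Anc⇒≤ here      nz = nz , inj₁ refl
    Anc⇒≤ (up e dp) nz with parent-below nz e
    ... | np , p<z with Anc⇒≤ dp np
    ...   | nd , d≤p = nd , inj₂ (≤-<-trans d≤p p<z)

    NCA-fromUpperBound : ∀ {x y m} → Anc par m x → Anc par m y → Node x
                       → (∀ d → Anc par d x → Anc par d y → d ≤ m) → NCA par x y m
    NCA-fromUpperBound {m = m} mx my nx bound = mx , my , greatest
      where
      greatest : ∀ d → Anc par d _ → Anc par d _ → Anc par d m
      greatest d dx dy with Anc-connex dx mx
      ... | inj₁ dm = dm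
      ... | inj₂ md with ≤-antisym (bound d dx dy) (proj₂ (Anc⇒≤ md (proj₁ (Anc⇒≤ dx nx))))
      ...   | refl = here

module HeapTreeProperties {a ℓ} {A : Set a} {_<_ : Rel A ℓ}
                          (sto : IsStrictTotalOrder _≡_ _<_) (T : HeapTree A _<_) where
  open IsStrictTotalOrder sto using (_≟_; _<?_; irrefl) renaming (trans to <-trans)
  open NonStrict sto
  open HeapTree T

  Node : A → Set a
  Node z = z ∈ nodes

  parent-below : ∀ {z p} → Node z → parent z ≡ just p → Node p × p < z
  parent-below nz e = parent-node nz e , heap-order nz e

  open HeapOrdered parent Node parent-below public

  countBelow : A → List A → ℕ
  countBelow x []       = 0
  countBelow x (y ∷ ys) with y <? x
  ... | yes _ = suc (countBelow x ys)
  ... | no  _ = countBelow x ys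

  countBelow-mono : ∀ {p x} → p < x → ∀ ys → countBelow p ys ≤ℕ countBelow x ys
  countBelow-mono p<x [] = z≤n
  countBelow-mono {p} {x} p<x (y ∷ ys) with y <? p | y <? x
  ... | yes _   | yes _   = s≤s (countBelow-mono p<x ys)
  ... | yes y<p | no  y≮x = ⊥-elim (y≮x (<-trans y<p p<x))
  ... | no  _   | yes _   = m≤n⇒m≤1+n (countBelow-mono p<x ys)
  ... | no  _   | no  _   = countBelow-mono p<x ys

  countBelow-strict : ∀ {p x} → p < x → ∀ ys → p ∈ ys → countBelow p ys <ℕ countBelow x ys
  countBelow-strict {p} {x} p<x (y ∷ ys) (here refl) with y <? p | y <? x
  ... | yes p<p | _       = ⊥-elim (irrefl refl p<p)
  ... | no  _   | yes _   = s≤s (countBelow-mono p<x ys)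
  ... | no  _   | no  p≮x = ⊥-elim (p≮x p<x)
  countBelow-strict {p} {x} p<x (y ∷ ys) (there p∈ys) with y <? p | y <? x
  ... | yes _   | yes _   = s≤s (countBelow-strict p<x ys p∈ys)
  ... | yes y<p | no  y≮x = ⊥-elim (y≮x (<-trans y<p p<x))
  ... | no  _   | yes _   = m≤n⇒m≤1+n (countBelow-strict p<x ys p∈ys)
  ... | no  _   | no  _   = countBelow-strict p<x ys p∈ys

  _⊏_ : Rel A (a ⊔ ℓ)
  p ⊏ x = Node p × p < x

  ⊏-wellFounded : WellFounded _⊏_
  ⊏-wellFounded = Subrelation.wellFounded (λ (np , p<x) → countBelow-strict p<x nodes np)
                                          (On.wellFounded (λ x → countBelow x nodes) <-wellFounded)

  node-induction : ∀ {b} (P : A → Set b)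
                 → (∀ x → Node x → (∀ p → Node p → p < x → P p) → P x)
                 → ∀ x → Node x → P x
  node-induction P go = All.wfRec ⊏-wellFounded _ (λ x → Node x → P x)
                            (λ x rec nx → go x nx (λ p np p<x → rec (np , p<x) np))

  Anc? : ∀ c x → Node x → Dec (Anc parent c x)
  Anc? c = node-induction (λ x → Dec (Anc parent c x)) go
    where
    go : ∀ x → Node x → (∀ p → Node p → p < x → Dec (Anc parent c p)) → Dec (Anc parent c x)
    go x nx rec with c ≟ x
    ... | yes refl = yes here
    ... | no c≢x with parent x in e
    ...   | nothing = no λ cx → c≢x (Anc-orphan⇒≡ e cx)
    ...   | just p with rec p (parent-node nx e) (heap-order nx e)
    ...     | yes cp = yes (up e cp)
    ...     | no ¬cp = no λ cx → [ c≢x , ¬cp ]′ (Anc-parent⁻¹ cx e)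

  root-Anc : ∀ x → Node x → Anc parent root x
  root-Anc = node-induction (Anc parent root) go
    where
    go : ∀ x → Node x → (∀ p → Node p → p < x → Anc parent root p) → Anc parent root x
    go x nx rec with parent x in e
    ... | nothing rewrite unique-root nx e = here
    ... | just p  = up e (rec p (parent-node nx e) (heap-order nx e))

  nca : ∀ y → Node y → ∀ x → Node x → ∃[ m ] NCA parent x y m
  nca y ny = node-induction (λ x → ∃[ m ] NCA parent x y m) go
    where
    go : ∀ x → Node x → (∀ p → Node p → p < x → ∃[ m ] NCA parent p y m) → ∃[ m ] NCA parent x y m
    go x nx rec with Anc? x y ny
    ... | yes xy = x , here , xy , λ d dx _ → dx
    ... | no ¬xy with parent x in e
    ...   | nothing = ⊥-elim (¬xy (subst (λ r → Anc parent r y) (sym (unique-root nx e)) (root-Anc y ny)))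
    ...   | just p with rec p (parent-node nx e) (heap-order nx e)
    ...     | m , mp , my , greatest = m , up e mp , my , greatest′
      where
      greatest′ : ∀ d → Anc parent d x → Anc parent d y → Anc parent d m
      greatest′ d dx dy = [ (λ { refl → ⊥-elim (¬xy dy) }) , (λ dp → greatest d dp dy) ]′ (Anc-parent⁻¹ dx e)

  module Walks (N : A → Set a) (N⊆Node : ∀ {z} → N z → Node z) where
    open import Data.List.Membership.DecPropositional _≟_ using (_∈?_)

    Walk-head : ∀ {x y ps} → Walk N parent x y ps → x ∈ ps
    Walk-head (stop _)   = here refl
    Walk-head (step _ _) = here refl

    Walk-⊆ : ∀ {x y ps z} → Walk N parent x y ps → z ∈ ps → N z
    Walk-⊆ (stop nx)               (here refl) = nx
    Walk-⊆ (step (nx , _ , _) _)   (here refl) = nx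
    Walk-⊆ (step _ walk)           (there z∈)  = Walk-⊆ walk z∈

    Walk-∋-exit : ∀ {x y ps c p} → Walk N parent x y ps → Anc parent c x → ¬ Anc parent c y
                → parent c ≡ just p → p ∈ ps
    Walk-∋-exit (stop _) cx ¬cy _ = ⊥-elim (¬cy cx)
    Walk-∋-exit {c = c} (step {c = x′} (_ , nx′ , edge) walk) cx ¬cy e with Anc? c x′ (N⊆Node nx′)
    ... | yes cx′ = there (Walk-∋-exit walk cx′ ¬cy e)
    ... | no ¬cx′ with edge
    ...   | inj₂ x′→x = ⊥-elim (¬cx′ (up x′→x cx))
    ...   | inj₁ x→x′ with Anc-¬parent⇒≡ cx ¬cx′ x→x′
    ...     | refl with trans (sym e) x→x′
    ...       | refl = there (Walk-head walk)

    Walk-∋-entry : ∀ {x y ps c} → Walk N parent x y ps → ¬ Anc parent c x → Anc parent c y → c ∈ ps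
    Walk-∋-entry (stop _) ¬cx cy = ⊥-elim (¬cx cy)
    Walk-∋-entry {c = c} (step {c = x′} (_ , nx′ , edge) walk) ¬cx cy with Anc? c x′ (N⊆Node nx′)
    ... | no ¬cx′ = there (Walk-∋-entry walk ¬cx′ cy)
    ... | yes cx′ with edge
    ...   | inj₁ x→x′ = ⊥-elim (¬cx (up x→x′ cx′))
    ...   | inj₂ x′→x with Anc-¬parent⇒≡ cx′ ¬cx x′→x
    ...     | refl = there (Walk-head walk)

    Walk-∋-nca : ∀ {x y m ps} → Walk N parent x y ps → Node x → NCA parent x y m → m ∈ ps
    Walk-∋-nca {x} {y} {m} walk nx (mx , my , greatest) with m ≟ x
    ... | yes refl = Walk-head walk
    ... | no m≢x with child-towards mx m≢x
    ...   | c , c→m , cx = Walk-∋-exit walk cx ¬cy c→m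
      where
      ¬cy : ¬ Anc parent c y
      ¬cy cy = ≤⇒≯ (proj₂ (Anc⇒≤ (greatest c cx cy) (proj₁ (Anc⇒≤ mx nx))))
                   (heap-order (proj₁ (Anc⇒≤ cx nx)) c→m)

    -- A path cannot leave a subtree and come back, since that would repeat the subtree's parent.
    Path-⊆-subtree : ∀ {x y m ps z} → Walk N parent x y ps → Unique ps
                   → Anc parent m x → Anc parent m y → z ∈ ps → Anc parent m z
    Path-⊆-subtree (stop _)   _ mx _ (here refl) = mx
    Path-⊆-subtree (step _ _) _ mx _ (here refl) = mx
    Path-⊆-subtree {m = m} (step {c = x′} (_ , nx′ , edge) walk) (x∉ ∷ unique) mx my (there z∈)
      with Anc? m x′ (N⊆Node nx′)
    ... | yes mx′ = Path-⊆-subtree walk unique mx′ my z∈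
    ... | no ¬mx′ with edge
    ...   | inj₂ x′→x = ⊥-elim (¬mx′ (up x′→x mx))
    ...   | inj₁ x→x′ with Anc-¬parent⇒≡ mx ¬mx′ x→x′
    ...     | refl = ⊥-elim (All¬⇒¬Any x∉ (Walk-∋-entry walk ¬mx′ my))

    Path : A → A → Set a
    Path x y = ∃[ ps ] (Walk N parent x y ps × Unique ps)

    Path-suffix : ∀ {c y ps x} → Walk N parent c y ps → Unique ps → x ∈ ps → Path x y
    Path-suffix walk@(stop _)   unique (here refl) = _ , walk , unique
    Path-suffix walk@(step _ _) unique (here refl) = _ , walk , unique
    Path-suffix (step _ walk) (_ ∷ unique) (there x∈) = Path-suffix walk unique x∈

    Walk⇒Path : ∀ {x y ps} → Walk N parent x y ps → Path x y
    Walk⇒Path (stop nx) = _ , stop nx , [] ∷ []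
    Walk⇒Path {x} (step edge walk) with Walk⇒Path walk
    ... | qs , path , unique with x ∈? qs
    ...   | yes x∈ = Path-suffix path unique x∈
    ...   | no  x∉ = x ∷ qs , step edge path , ¬Any⇒All¬ qs x∉ ∷ unique

    Adj-sym : ∀ {x y} → Adj N parent x y → Adj N parent y x
    Adj-sym (nx , ny , edge) = ny , nx , [ inj₂ , inj₁ ]′ edge

    Walks : A → A → Set a
    Walks x y = ∃[ ps ] Walk N parent x y ps

    Walk-snoc : ∀ {x y z ps} → Walk N parent x y ps → Adj N parent y z → Walks x z
    Walk-snoc (stop _)      edge = _ , step edge (stop (proj₁ (proj₂ edge)))
    Walk-snoc (step e walk) edge = _ , step e (proj₂ (Walk-snoc walk edge))

    Walk-reverse : ∀ {x y ps} → Walk N parent x y ps → Walks y x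
    Walk-reverse (stop nx)      = _ , stop nx
    Walk-reverse (step e walk) = Walk-snoc (proj₂ (Walk-reverse walk)) (Adj-sym e)

    Walk-++ : ∀ {x m y ps qs} → Walk N parent x m ps → Walk N parent m y qs → Walks x y
    Walk-++ (stop _)      walk′ = _ , walk′
    Walk-++ (step e walk) walk′ = _ , step e (proj₂ (Walk-++ walk walk′))

    Walk-up : ∀ {m x} → Anc parent m x → (∀ c → Anc parent m c → Anc parent c x → N c) → Walks x m
    Walk-up {m} here inN = _ , stop (inN m here here)
    Walk-up {x = x} (up {c = p} e mp) inN =
      _ , step (inN x (up e mp) here , inN p mp (up e here) , inj₁ e)
               (proj₂ (Walk-up mp (λ c mc cp → inN c mc (Anc-trans cp (up e here)))))

    NCA⇒IsMin-OnPath : ∀ {x y m} → N x → N y → NCA parent x y m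
                     → (∀ c → Anc parent m c → Anc parent c x ⊎ Anc parent c y → N c)
                     → IsMin _<_ (OnPath N parent x y) m
    NCA⇒IsMin-OnPath {x} {y} {m} nx ny nca@(mx , my , _) inN =
      (ps , path , unique , Walk-∋-nca path (N⊆Node nx) nca) , least
      where
      x⇝m = Walk-up mx (λ c mc cx → inN c mc (inj₁ cx))
      y⇝m = Walk-up my (λ c mc cy → inN c mc (inj₂ cy))
      x⇝y = Walk⇒Path (proj₂ (Walk-++ (proj₂ x⇝m) (proj₂ (Walk-reverse (proj₂ y⇝m)))))
      ps = proj₁ x⇝y
      path = proj₁ (proj₂ x⇝y)
      unique = proj₂ (proj₂ x⇝y)
      least : ∀ z → OnPath N parent x y z → m ≡ z ⊎ m < z
      least z (_ , walk , unique′ , z∈) =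
        proj₂ (Anc⇒≤ (Path-⊆-subtree walk unique′ mx my z∈) (N⊆Node (Walk-⊆ walk z∈)))

  nca-isMin-path : ∀ {x y m} → Node x → Node y → NCA parent x y m → IsMin _<_ (OnPath Node parent x y) m
  nca-isMin-path nx ny m-nca =
    Walks.NCA⇒IsMin-OnPath Node id nx ny m-nca
      (λ c _ → [ (λ cx → proj₁ (Anc⇒≤ cx nx)) , (λ cy → proj₁ (Anc⇒≤ cy ny)) ]′)

module MergeProperties {a ℓ} {A : Set a} {_<_ : Rel A ℓ} (sto : IsStrictTotalOrder _≡_ _<_)
                       (T : HeapTree A _<_) (v w : A) (nv : v ∈ HeapTree.nodes T) (nw : w ∈ HeapTree.nodes T)
                       (par′ : A → Maybe A) (merge : IsMerge T v w par′) where
  open NonStrict sto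
  open HeapTree T
  open HeapTreeProperties sto T

  PQ : A → Set a
  PQ = InPQ T v w

  PQ⇒Node : ∀ {z} → PQ z → Node z
  PQ⇒Node (inj₁ zv) = proj₁ (Anc⇒≤ zv nv)
  PQ⇒Node (inj₂ zw) = proj₁ (Anc⇒≤ zw nw)

  PQ-downward : ∀ {x z} → PQ z → Anc parent x z → PQ x
  PQ-downward (inj₁ zv) xz = inj₁ (Anc-trans xz zv)
  PQ-downward (inj₂ zw) xz = inj₂ (Anc-trans xz zw)

  PQ? : ∀ z → Dec (PQ z)
  PQ? z with Anc? z v nv | Anc? z w nw
  ... | yes zv  | _       = yes (inj₁ zv)
  ... | no  _   | yes zw  = yes (inj₂ zw)
  ... | no  ¬zv | no  ¬zw = no [ ¬zv , ¬zw ]′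

  merged-parent : ∀ {z p} → par′ z ≡ just p → PQ z → PQ p × p < z × (∀ r → PQ r → r < z → r ≤ p)
  merged-parent {z} e pz with proj₁ merge z pz
  ... | inj₂ (_ , e′) with trans (sym e′) e
  ...   | ()
  merged-parent {z} e pz | inj₁ (p , pp , p<z , p-max , e′) with trans (sym e′) e
  ... | refl = pp , p<z , λ r pr r<z → [ (λ r≤p → r≤p) , (λ p<r → ⊥-elim (p-max r pr r<z p<r)) ]′ (≤⊎> r p)

  merged-parent-below : ∀ {z p} → Node z → par′ z ≡ just p → Node p × p < z
  merged-parent-below {z} nz e with PQ? z
  ... | no ¬pz = parent-below nz (trans (sym (proj₂ merge z ¬pz)) e)
  ... | yes pz with merged-parent e pz
  ...   | pp , p<z , _ = PQ⇒Node pp , p<z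

  module Merged = HeapOrdered par′ Node merged-parent-below

  PQ-chain : ∀ z → Node z → ∀ x → PQ x → PQ z → x ≤ z → Anc par′ x z
  PQ-chain = node-induction (λ z → ∀ x → PQ x → PQ z → x ≤ z → Anc par′ x z) go
    where
    go : ∀ z → Node z → (∀ p → Node p → p < z → ∀ x → PQ x → PQ p → x ≤ p → Anc par′ x p)
       → ∀ x → PQ x → PQ z → x ≤ z → Anc par′ x z
    go z nz rec x px pz (inj₁ refl) = here
    go z nz rec x px pz (inj₂ x<z) with proj₁ merge z pz
    ... | inj₂ (nothing-below , _) = ⊥-elim (nothing-below x px x<z)
    ... | inj₁ (p , pp , p<z , _ , e) with merged-parent e pz
    ...   | _ , _ , p-max = up e (rec p (PQ⇒Node pp) p<z x px pp (p-max x px x<z))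

  Anc⇒merged-Anc : ∀ {x z} → Anc parent x z → Node z → Anc par′ x z
  Anc⇒merged-Anc here nz = here
  Anc⇒merged-Anc {z = z} (up {c = c} e xc) nz with Anc⇒merged-Anc xc (parent-node nz e) | PQ? z
  ... | xc′ | no ¬pz = up (trans (proj₂ merge z ¬pz) e) xc′
  ... | xc′ | yes pz with proj₁ merge z pz
  ...   | inj₂ (nothing-below , _) = ⊥-elim (nothing-below c (PQ-downward pz (up e here)) (heap-order nz e))
  ...   | inj₁ (p , pp , _ , _ , e′) with merged-parent e′ pz
  ...     | _ , _ , p-max = up e′ (Anc-trans xc′ (PQ-chain p (PQ⇒Node pp) c pc pp (p-max c pc (heap-order nz e))))
    where pc = PQ-downward pz (up e here)

  AncViaPQ : A → A → Set (a ⊔ ℓ)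
  AncViaPQ d z = PQ d × ∃[ b ] (PQ b × Anc parent b z × d ≤ b)

  merged-Anc⇒ : ∀ {d z} → Anc par′ d z → Node z → Anc parent d z ⊎ AncViaPQ d z
  merged-Anc⇒ here nz = inj₁ here
  merged-Anc⇒ {d} {z} (up {c = c} e dc) nz with merged-Anc⇒ dc (proj₁ (merged-parent-below nz e)) | PQ? z
  ... | ih | no ¬pz = extend ih
    where
    e₁ = trans (sym (proj₂ merge z ¬pz)) e
    extend : Anc parent d c ⊎ AncViaPQ d c → Anc parent d z ⊎ AncViaPQ d z
    extend (inj₁ dc₁)                     = inj₁ (up e₁ dc₁)
    extend (inj₂ (pd , b , pb , bc , d≤b)) = inj₂ (pd , b , pb , up e₁ bc , d≤b)
  ... | ih | yes pz with merged-parent e pz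
  ...   | pc , c<z , _ = inj₂ (via ih)
    where
    nc = PQ⇒Node pc
    via : Anc parent d c ⊎ AncViaPQ d c → AncViaPQ d z
    via (inj₁ dc₁) = PQ-downward pc dc₁ , z , pz , here , inj₂ (≤-<-trans (proj₂ (Anc⇒≤ dc₁ nc)) c<z)
    via (inj₂ (pd , b , _ , bc , d≤b)) =
      pd , z , pz , here , inj₂ (≤-<-trans (≤-trans d≤b (proj₂ (Anc⇒≤ bc nc))) c<z)

  CommonAncViaPQ : A → A → A → Set (a ⊔ ℓ)
  CommonAncViaPQ d x y = ∃[ bx ] ∃[ by ] (PQ bx × Anc parent bx x × d ≤ bx × PQ by × Anc parent by y × d ≤ by)

  merged-common-Anc⇒ : ∀ {d x y} → Anc par′ d x → Anc par′ d y → Node x → Node y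
                     → (Anc parent d x × Anc parent d y) ⊎ CommonAncViaPQ d x y
  merged-common-Anc⇒ dx dy nx ny with merged-Anc⇒ dx nx | merged-Anc⇒ dy ny
  ... | inj₁ dx₁ | inj₁ dy₁ = inj₁ (dx₁ , dy₁)
  ... | inj₁ dx₁ | inj₂ (pd , by , pby , byy , d≤by) = inj₂ (_ , by , pd , dx₁ , inj₁ refl , pby , byy , d≤by)
  ... | inj₂ (pd , bx , pbx , bxx , d≤bx) | inj₁ dy₁ = inj₂ (bx , _ , pbx , bxx , d≤bx , pd , dy₁ , inj₁ refl)
  ... | inj₂ (_ , bx , pbx , bxx , d≤bx) | inj₂ (_ , by , pby , byy , d≤by) =
        inj₂ (bx , by , pbx , bxx , d≤bx , pby , byy , d≤by)

module MergeNCA {a ℓ} {A : Set a} {_<_ : Rel A ℓ} (sto : IsStrictTotalOrder _≡_ _<_)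
                (T₁ : HeapTree A _<_) (v w u q : A)
                (nv : v ∈ HeapTree.nodes T₁) (nw : w ∈ HeapTree.nodes T₁)
                (u-nca : NCA (HeapTree.parent T₁) v w u)
                (q→u : HeapTree.parent T₁ q ≡ just u) (qv : Anc (HeapTree.parent T₁) q v)
                (par′ : A → Maybe A) (merge : IsMerge T₁ v w par′) where
  open NonStrict sto
  open HeapTree T₁
  open HeapTreeProperties sto T₁
  open MergeProperties sto T₁ v w nv nw par′ merge

  InT₂ : A → Set a
  InT₂ z = Anc parent q z

  uv : Anc parent u v
  uv = proj₁ u-nca

  uw : Anc parent u w
  uw = proj₁ (proj₂ u-nca)

  InT₂⇒Anc : ∀ {c z} → Anc parent c z → InT₂ z → InT₂ c ⊎ Anc parent c u
  InT₂⇒Anc cz qz with Anc-connex cz qz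
  ... | inj₂ qc = inj₁ qc
  ... | inj₁ cq = [ (λ { refl → inj₁ here }) , inj₂ ]′ (Anc-parent⁻¹ cq q→u)

  ¬InT₂-w : ¬ InT₂ w
  ¬InT₂-w qw = ≤⇒≯ (proj₂ (Anc⇒≤ (proj₂ (proj₂ u-nca) q qv qw) (parent-node nq q→u))) (heap-order nq q→u)
    where nq = proj₁ (Anc⇒≤ qv nv)

  incomparable-PQ : ∀ {b b′} → Anc parent b v → Anc parent b′ w
                  → ¬ Anc parent b b′ → ¬ Anc parent b′ b
                  → InT₂ b × ¬ InT₂ b′ × ¬ Anc parent b′ u
  incomparable-PQ bv b′w ¬bb′ ¬b′b =
      [ (λ qb → qb) , (λ bu → ⊥-elim (incomparable (Anc-trans bu uw) b′w ¬bb′ ¬b′b)) ]′ (InT₂⇒Anc bv qv)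
    , (λ qb′ → ¬InT₂-w (Anc-trans qb′ b′w))
    , (λ b′u → incomparable bv (Anc-trans b′u uv) ¬bb′ ¬b′b)
    where
    incomparable : ∀ {c d z} → Anc parent c z → Anc parent d z → ¬ Anc parent c d → ¬ Anc parent d c → ⊥
    incomparable cz dz ¬cd ¬dc = [ ¬cd , ¬dc ]′ (Anc-connex cz dz)

  outside-T₂ : ∀ {b y} → Anc parent b y → ¬ InT₂ b → ¬ Anc parent b u → ¬ InT₂ y
  outside-T₂ by ¬qb ¬bu qy = [ ¬qb , ¬bu ]′ (InT₂⇒Anc by qy)

  Separated : A → A → Set a
  Separated x y = (InT₂ x × ¬ InT₂ y) ⊎ (InT₂ y × ¬ InT₂ x)

  -- Lying above the old nca, bx and by are incomparable, so they cannot both lie on P or both on Q.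
  separated : ∀ {x y m bx by} → NCA parent x y m → Node x
            → PQ bx → Anc parent bx x → PQ by → Anc parent by y → m < bx → m < by → Separated x y
  separated {x} {y} {m} {bx} {by} (mx , my , greatest) nx pbx bxx pby byy m<bx m<by = go pbx pby
    where
    nm = proj₁ (Anc⇒≤ mx nx)
    ¬bx-by : ¬ Anc parent bx by
    ¬bx-by bx-by = ≤⇒≯ (proj₂ (Anc⇒≤ (greatest bx bxx (Anc-trans bx-by byy)) nm)) m<bx
    ¬by-bx : ¬ Anc parent by bx
    ¬by-bx by-bx = ≤⇒≯ (proj₂ (Anc⇒≤ (greatest by (Anc-trans by-bx bxx) byy) nm)) m<by
    go : PQ bx → PQ by → Separated x y
    go (inj₁ bxv) (inj₁ byv) = ⊥-elim ([ ¬bx-by , ¬by-bx ]′ (Anc-connex bxv byv))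
    go (inj₂ bxw) (inj₂ byw) = ⊥-elim ([ ¬bx-by , ¬by-bx ]′ (Anc-connex bxw byw))
    go (inj₁ bxv) (inj₂ byw) with incomparable-PQ bxv byw ¬bx-by ¬by-bx
    ... | qbx , ¬qby , ¬byu = inj₁ (Anc-trans qbx bxx , outside-T₂ byy ¬qby ¬byu)
    go (inj₂ bxw) (inj₁ byv) with incomparable-PQ byv bxw ¬by-bx ¬bx-by
    ... | qby , ¬qbx , ¬bxu = inj₂ (Anc-trans qby byy , outside-T₂ bxx ¬qbx ¬bxu)

  nca-merged-unseparated : ∀ x y → Node x → Node y → ¬ Separated x y
                         → ∃[ m ] (IsMin _<_ (OnPath Node parent x y) m × NCA par′ x y m)
  nca-merged-unseparated x y nx ny ¬sep with nca y ny x nx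
  ... | m , m-nca@(mx , my , greatest) =
        m , nca-isMin-path nx ny m-nca , Merged.NCA-fromUpperBound (Anc⇒merged-Anc mx nx) (Anc⇒merged-Anc my ny) nx bound
    where
    bound : ∀ d → Anc par′ d x → Anc par′ d y → d ≤ m
    bound d dx dy with merged-common-Anc⇒ dx dy nx ny
    ... | inj₁ (dx₁ , dy₁) = proj₂ (Anc⇒≤ (greatest d dx₁ dy₁) (proj₁ (Anc⇒≤ mx nx)))
    ... | inj₂ (bx , by , pbx , bxx , d≤bx , pby , byy , d≤by) with ≤⊎> d m
    ...   | inj₁ d≤m = d≤m
    ...   | inj₂ m<d = ⊥-elim (¬sep (separated m-nca nx pbx bxx pby byy (<-≤-trans m<d d≤bx) (<-≤-trans m<d d≤by)))

  InT₂-Node : A → Set a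
  InT₂-Node z = Node z × InT₂ z

  nca-isMin-path-T₂ : ∀ {x a} → Node x → InT₂ x → NCA parent x v a
                    → IsMin _<_ (OnPath InT₂-Node parent x v) a
  nca-isMin-path-T₂ nx qx a-nca@(ax , _ , a-greatest) =
    Walks.NCA⇒IsMin-OnPath InT₂-Node proj₁ (nx , qx) (nv , qv) a-nca
      (λ c ac → λ { (inj₁ cx) → proj₁ (Anc⇒≤ cx nx) , Anc-trans qa ac
                  ; (inj₂ cv) → proj₁ (Anc⇒≤ cv nv) , Anc-trans qa ac })
    where qa = a-greatest q qx qv

  PQ-Anc-T₂⇒≤nca : ∀ {x a c} → Node x → InT₂ x → NCA parent x v a → PQ c → Anc parent c x → c ≤ a
  PQ-Anc-T₂⇒≤nca nx qx (ax , _ , a-greatest) pc cx = proj₂ (Anc⇒≤ (a-greatest _ cx (cv pc)) (proj₁ (Anc⇒≤ ax nx)))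
    where
    cv : PQ _ → Anc parent _ v
    cv (inj₁ cv′) = cv′
    cv (inj₂ cw) = [ (λ qc → ⊥-elim (¬InT₂-w (Anc-trans qc cw))) , (λ cu → Anc-trans cu uv) ]′ (InT₂⇒Anc cx qx)

  PQ-Anc-¬T₂⇒≤nca : ∀ {y b c} → ¬ InT₂ y → NCA parent w y b → PQ c → Anc parent c y → c ≤ b
  PQ-Anc-¬T₂⇒≤nca ¬qy (bw , _ , b-greatest) pc cy = proj₂ (Anc⇒≤ (b-greatest _ (cw pc) cy) (proj₁ (Anc⇒≤ bw nw)))
    where
    cw : PQ _ → Anc parent _ w
    cw (inj₂ cw′) = cw′
    cw (inj₁ cv) = [ (λ qc → ⊥-elim (¬qy (Anc-trans qc cy))) , (λ cu → Anc-trans cu uw) ]′ (InT₂⇒Anc cv qv)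

  nca-merged-separated : ∀ x y → Node x → Node y → InT₂ x → ¬ InT₂ y
    → ∃[ m ] (IsMin _<_ (λ z → OnPath InT₂-Node parent x v z ⊎ OnPath Node parent w y z) m × NCA par′ x y m)
  nca-merged-separated x y nx ny qx ¬qy with nca v nv x nx | nca y ny w nw
  ... | a , a-nca@(ax , av , _) | b , b-nca@(bw , by , _)
      with IsMin-∪ (nca-isMin-path-T₂ nx qx a-nca) (nca-isMin-path nw ny b-nca)
  ... | m , m-min@(_ , m-least) , m≡a⊎b = m , m-min , Merged.NCA-fromUpperBound mx my nx bound
    where
    na = proj₁ (Anc⇒≤ ax nx)
    nb = proj₁ (Anc⇒≤ bw nw)
    m≤a = m-least a (inj₁ (proj₁ (nca-isMin-path-T₂ nx qx a-nca)))
    m≤b = m-least b (inj₂ (proj₁ (nca-isMin-path nw ny b-nca)))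
    pm : PQ m
    pm = [ (λ { refl → inj₁ av }) , (λ { refl → inj₂ bw }) ]′ m≡a⊎b
    mx = Anc-trans (PQ-chain a na m pm (inj₁ av) m≤a) (Anc⇒merged-Anc ax nx)
    my = Anc-trans (PQ-chain b nb m pm (inj₂ bw) m≤b) (Anc⇒merged-Anc by ny)
    below-both : ∀ {d} → Anc par′ d x → Anc par′ d y → d ≤ a × d ≤ b
    below-both dx dy with merged-common-Anc⇒ dx dy nx ny
    ... | inj₂ (_ , _ , pbx , bxx , d≤bx , pby , byy , d≤by) =
          ≤-trans d≤bx (PQ-Anc-T₂⇒≤nca nx qx a-nca pbx bxx) , ≤-trans d≤by (PQ-Anc-¬T₂⇒≤nca ¬qy b-nca pby byy)
    ... | inj₁ (dx₁ , dy₁) with InT₂⇒Anc dx₁ qx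
    ...   | inj₁ qd = ⊥-elim (¬qy (Anc-trans qd dy₁))
    ...   | inj₂ du = PQ-Anc-T₂⇒≤nca nx qx a-nca pd dx₁ , PQ-Anc-¬T₂⇒≤nca ¬qy b-nca pd dy₁
      where pd = inj₁ (Anc-trans du uv)
    bound : ∀ d → Anc par′ d x → Anc par′ d y → d ≤ m
    bound d dx dy = [ (λ { refl → proj₁ (below-both dx dy) }) , (λ { refl → proj₂ (below-both dx dy) }) ]′ m≡a⊎b

  same-side⇒¬Separated : ∀ {x y} → Node x → Node y
                       → (InT₂-Node x × InT₂-Node y) ⊎ (¬ InT₂-Node x × ¬ InT₂-Node y) → ¬ Separated x y
  same-side⇒¬Separated _  _  (inj₁ ((_ , qx) , (_ , qy))) = [ (λ (_ , ¬qy) → ¬qy qy) , (λ (_ , ¬qx) → ¬qx qx) ]′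
  same-side⇒¬Separated nx ny (inj₂ (x∉ , y∉)) = [ (λ (qx , _) → x∉ (nx , qx)) , (λ (qy , _) → y∉ (ny , qy)) ]′

lemma6 : ∀ {a ℓ} {A : Set a} {_<_ : Rel A ℓ}
  → IsStrictTotalOrder _≡_ _<_
  → (T₁ : HeapTree A _<_)
  → (v w u q : A)
  → v ∈ HeapTree.nodes T₁ → w ∈ HeapTree.nodes T₁
  → NCA (HeapTree.parent T₁) v w u → ¬ (u ≡ v) → ¬ (u ≡ w)
  → HeapTree.parent T₁ q ≡ just u → Anc (HeapTree.parent T₁) q v
  → (par : A → Maybe A) → IsMerge T₁ v w par
  → (x y : A) → x ∈ HeapTree.nodes T₁ → y ∈ HeapTree.nodes T₁
  → let N₁ = λ z → z ∈ HeapTree.nodes T₁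
        N₂ = λ z → z ∈ HeapTree.nodes T₁ × Anc (HeapTree.parent T₁) q z
    in ((N₂ x × N₂ y) ⊎ (¬ N₂ x × ¬ N₂ y)
         → ∃[ m ] (IsMin _<_ (OnPath N₁ (HeapTree.parent T₁) x y) m
                   × NCA par x y m))
     × (N₂ x × ¬ N₂ y
         → ∃[ m ] (IsMin _<_ (λ z → OnPath N₂ (HeapTree.parent T₁) x v z
                                      ⊎ OnPath N₁ (HeapTree.parent T₁) w y z) m
                   × NCA par x y m))
     × (N₂ y × ¬ N₂ x
         → ∃[ m ] (IsMin _<_ (λ z → OnPath N₂ (HeapTree.parent T₁) y v z
                                      ⊎ OnPath N₁ (HeapTree.parent T₁) w x z) m
                   × NCA par x y m))
lemma6 sto T₁ v w u q nv nw u-nca _ _ q→u qv par merge x y nx ny =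
    (λ same-side → nca-merged-unseparated x y nx ny (same-side⇒¬Separated nx ny same-side))
  , (λ ((_ , qx) , y∉) → nca-merged-separated x y nx ny qx (λ qy → y∉ (ny , qy)))
  , (λ ((_ , qy) , x∉) → let m , m-min , m-nca = nca-merged-separated y x ny nx qy (λ qx → x∉ (nx , qx))
                         in m , m-min , NCA-sym m-nca)
  where open MergeNCA sto T₁ v w u q nv nw u-nca q→u qv par merge
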